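{- For all $\Gamma$, $r$ and ordered contexts $\Omega_1,\Omega_2$ with $\Omega_1\Omega_2\geq r$ and all hypotheses of $\Omega_1\Omega_2$ in $\Gamma$: for every $\Omega\in\mathsf{NF}_{\Gamma,r}(\Omega_1\Omega_2)$ there exist $\Omega_1'\in\mathsf{NF}_{\Gamma,r}(\Omega_1)$ and $\Omega_2'\in\mathsf{NF}_{\Gamma,r}(\Omega_2)$ such that $\Omega_1'\Omega_2'\leadsto^{\Gamma}_{r}\Omega$.
   Context: Fix a preorder $(\mathcal{M},\geq)$ of modes and, for each mode $m$, a set $\sigma(m)\subseteq\{\mathsf{W},\mathsf{C}^\leftarrow,\mathsf{C}^\rightarrow,\mathsf{M}^\leftarrow,\mathsf{M}^\rightarrow\}$ (weakening, left/right contraction, left/right mobility), monotone: $k\geq m$ implies $\sigma(k)\supseteq\sigma(m)$, and satisfying: if $\mathsf{W},\mathsf{C}^\leftarrow\in\sigma(m)$ then $\mathsf{M}^\leftarrow\in\sigma(m)$; if $\mathsf{W},\mathsf{C}^\rightarrow\in\sigma(m)$ then $\mathsf{M}^\rightarrow\in\sigma(m)$. Propositions $A_m$ are indexed by modes. An ordered context $\Omega$ is a finite sequence of labeled hypotheses $x{:}A_m$ (repetitions allowed, each variable always labeling the same proposition); $|\Omega|$ is its set of variables; $\Omega\geq r$ means every $y{:}B_k$ in $\Omega$ has $k\geq r$; $\Omega$ is normal ($\Omega\ \mathsf{nf}$) if no variable occurs twice. $\Gamma$ is an unordered finite set of labeled hypotheses. The relation $\Omega\leadsto^{\Gamma}_{r}\Omega'$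 is generated by the rules (premise $\Rightarrow$ conclusion): (W) $\Omega_L(x{:}A_m)\Omega_R\leadsto\Omega'$, $\mathsf{W}\in\sigma(m)$, $m\geq r$, $x{:}A_m\in\Gamma$, $x\notin|\Omega_L\Omega_R|\Rightarrow\Omega_L\Omega_R\leadsto\Omega'$; ($\mathsf{C}^\leftarrow$) $\Omega_L(x{:}A_m)\Omega_M\Omega_R\leadsto\Omega'$, $\mathsf{C}^\leftarrow\in\sigma(m)\Rightarrow\Omega_L(x{:}A_m)\Omega_M(x{:}A_m)\Omega_R\leadsto\Omega'$; ($\mathsf{C}^\rightarrow$) $\Omega_L\Omega_M(x{:}A_m)\Omega_R\leadsto\Omega'$, $\mathsf{C}^\rightarrow\in\sigma(m)\Rightarrow\Omega_L(x{:}A_m)\Omega_M(x{:}A_m)\Omega_R\leadsto\Omega'$; ($\mathsf{M}^\leftarrow$) $\Omega_L(x{:}A_m)\Omega_M\Omega_R\leadsto\Omega'$, $\mathsf{M}^\leftarrow\in\sigma(m)\Rightarrow\Omega_L\Omega_M(x{:}A_m)\Omega_R\leadsto\Omega'$; ($\mathsf{M}^\rightarrow$) $\Omega_L\Omega_M(x{:}A_m)\Omega_R\leadsto\Omega'$, $\mathsf{M}^\rightarrow\in\sigma(m)\Rightarrow\Omega_L(x{:}A_m)\Omega_M\Omega_R\leadsto\Omega'$; (id) $\Omega\ \mathsf{nf}\Rightarrow\Omega\leadsto\Omega$. (All arrows carry the same $\Gamma$, $r$.) $\mathsf{NF}_{\Gamma,r}(\Omega)=\{\Omega'\mid\Omega\leadsto^{\Gamma}_{r}\Omega'\}$.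 -}

module Defs where

open import Data.List using (List; []; _∷_; _++_)
open import Data.List.Membership.Propositional using (_∈_; _∉_)
open import Data.List.Relation.Unary.All using (All)
open import Data.List.Relation.Unary.Unique.Propositional using (Unique)
open import Data.Product using (Σ; _×_; _,_)
open import Relation.Binary.PropositionalEquality using (_≡_)
open import Relation.Binary.Structures using (IsPreorder)

-- Structural properties: weakening, left/right contraction, left/right mobility.
data Struct : Set where
  W Cˡ Cʳ Mˡ Mʳ : Struct

-- Hypotheses are represented by their variables; each variable carries a
-- globally fixed label x : A_m (mode m, proposition A of mode m), which
-- realises the convention that a variable always labels the same proposition.
record ModeSystem : Set₁ where
  field
    Mode    : Set
    _≥_     : Mode → Mode → Set
    isPreorder : IsPreorder _≡_ _≥_
    σ       : Mode → Struct → Set          -- σ m s  means  s ∈ σ(m)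
    σ-mono  : ∀ {k m s} → k ≥ m → σ m s → σ k s
    WCˡ⇒Mˡ  : ∀ {m} → σ m W → σ m Cˡ → σ m Mˡ
    WCʳ⇒Mʳ  : ∀ {m} → σ m W → σ m Cʳ → σ m Mʳ
    Prop    : Mode → Set
    Var     : Set
    modeOf  : Var → Mode
    propOf  : (x : Var) → Prop (modeOf x)

module Rules (S : ModeSystem) where
  open ModeSystem S public

  OCtx : Set
  OCtx = List Var

  -- unordered finite sets of labeled hypotheses
  UCtx : Set
  UCtx = List Var

  _≥ᶜ_ : OCtx → Mode → Set
  Ω ≥ᶜ r = All (λ y → modeOf y ≥ r) Ω

  nf : OCtx → Set
  nf Ω = Unique Ω

  data _⇝[_,_]_ : OCtx → UCtx → Mode → OCtx → Set where
    ⇝W  : ∀ {Γ r Ω'} Ωₗ Ωᵣ x →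
          (Ωₗ ++ x ∷ Ωᵣ) ⇝[ Γ , r ] Ω' → σ (modeOf x) W → modeOf x ≥ r →
          x ∈ Γ → x ∉ (Ωₗ ++ Ωᵣ) →
          (Ωₗ ++ Ωᵣ) ⇝[ Γ , r ] Ω'
    ⇝Cˡ : ∀ {Γ r Ω'} Ωₗ Ωₘ Ωᵣ x →
          (Ωₗ ++ x ∷ Ωₘ ++ Ωᵣ) ⇝[ Γ , r ] Ω' → σ (modeOf x) Cˡ →
          (Ωₗ ++ x ∷ Ωₘ ++ x ∷ Ωᵣ) ⇝[ Γ , r ] Ω'
    ⇝Cʳ : ∀ {Γ r Ω'} Ωₗ Ωₘ Ωᵣ x →
          (Ωₗ ++ Ωₘ ++ x ∷ Ωᵣ) ⇝[ Γ , r ] Ω' → σ (modeOf x) Cʳ →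
          (Ωₗ ++ x ∷ Ωₘ ++ x ∷ Ωᵣ) ⇝[ Γ , r ] Ω'
    ⇝Mˡ : ∀ {Γ r Ω'} Ωₗ Ωₘ Ωᵣ x →
          (Ωₗ ++ x ∷ Ωₘ ++ Ωᵣ) ⇝[ Γ , r ] Ω' → σ (modeOf x) Mˡ →
          (Ωₗ ++ Ωₘ ++ x ∷ Ωᵣ) ⇝[ Γ , r ] Ω'
    ⇝Mʳ : ∀ {Γ r Ω'} Ωₗ Ωₘ Ωᵣ x →
          (Ωₗ ++ Ωₘ ++ x ∷ Ωᵣ) ⇝[ Γ , r ] Ω' → σ (modeOf x) Mʳ →
          (Ωₗ ++ x ∷ Ωₘ ++ Ωᵣ) ⇝[ Γ , r ] Ω'
    ⇝id : ∀ {Γ r Ω} → nf Ω → Ω ⇝[ Γ , r ] Ω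

  NF : UCtx → Mode → OCtx → OCtx → Set
  NF Γ r Ω Ω' = Ω ⇝[ Γ , r ] Ω'

-- Two copies of a variable x in a context Z with Z ⇝ Ω can always be merged into one,
-- keeping the left copy (if x has Cˡ) or the right one (if x has Cʳ), so that the
-- smaller context still reaches Ω. This is proved by induction on a derivation whose
-- steps act at a single position, following how each step meets the two copies; a copy
-- that was itself produced by a contraction is merged with the copy it came from.
-- Merging duplicates inside Ω₂ and then inside Ω₁ until both are duplicate-free gives
-- Ω₂′ and Ω₁′ by contractions, and leaves a derivation of Ω₁′ Ω₂′ ⇝ Ω. Equality of
-- variables is not decidable, but it is decidable on the variables of Z, which all
-- occur in the duplicate-free Ω; this is how "no duplicates left" is detected.

module Submission where

open import Defs
open import Data.Empty using (⊥-elim)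
open import Data.List using (List; []; _∷_; _++_; [_]; length)
open import Data.List.Properties using (++-assoc; ++-identityʳ; ∷-injective)
open import Data.List.Membership.Propositional using (_∈_; _∉_)
open import Data.List.Membership.Propositional.Properties using (∈-∃++; ∈-++⁺ˡ; ∈-++⁺ʳ; ∈-++⁻)
open import Data.List.Relation.Binary.Permutation.Propositional using (↭-refl; ↭-swap)
open import Data.List.Relation.Binary.Permutation.Propositional.Properties using (∈-resp-↭; ++⁺ˡ)
open import Data.List.Relation.Binary.Subset.Propositional using (_⊆_)
open import Data.List.Relation.Unary.All as All using (All)
open import Data.List.Relation.Unary.All.Properties using (¬Any⇒All¬)
open import Data.List.Relation.Unary.AllPairs using ([]; _∷_)
open import Data.List.Relation.Unary.Any as Any using (here; there)
open import Data.List.Relation.Unary.Unique.Propositional using (Unique)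
open import Data.Nat using (_<_; s≤s)
open import Data.Nat.Induction using (<-wellFounded)
open import Data.Nat.Properties using (≤-refl)
open import Data.Product using (Σ; _×_; _,_; map₂)
open import Data.Sum as Sum using (_⊎_; inj₁; inj₂; [_,_]′)
open import Function using (id)
open import Induction.WellFounded using (Acc; acc)
open import Relation.Binary.PropositionalEquality using (_≡_; refl; sym; trans; cong; subst)
open import Relation.Nullary using (¬_; Dec; yes; no; _⊎-dec_)
import Relation.Nullary.Decidable as Dec

module _ {a} {A : Set a} where

  data HasDuplicate : List A → Set a where
    duplicate : ∀ L x M R → HasDuplicate (L ++ x ∷ M ++ x ∷ R)

  ≟-within-unique : ∀ {ys} {x y : A} → Unique ys → x ∈ ys → y ∈ ys → Dec (x ≡ y)
  ≟-within-unique _        (here refl) (here refl) = yes refl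
  ≟-within-unique (h∉ ∷ _) (here refl) (there y∈) = no λ { refl → All.lookup h∉ y∈ refl }
  ≟-within-unique (h∉ ∷ _) (there x∈) (here refl) = no λ { refl → All.lookup h∉ x∈ refl }
  ≟-within-unique (_ ∷ u)  (there x∈) (there y∈) = ≟-within-unique u x∈ y∈

  ∈?-within-unique : ∀ {ys} {x : A} xs → Unique ys → x ∈ ys → xs ⊆ ys → Dec (x ∈ xs)
  ∈?-within-unique []       _ _  _   = no λ ()
  ∈?-within-unique (w ∷ xs) u x∈ xs⊆ = Dec.map′ Any.fromSum Any.toSum
    (≟-within-unique u x∈ (xs⊆ (here refl)) ⊎-dec ∈?-within-unique xs u x∈ (λ p → xs⊆ (there p)))

  unique⊎duplicate : ∀ {ys} xs → Unique ys → xs ⊆ ys → Unique xs ⊎ HasDuplicate xs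
  unique⊎duplicate []       _ _   = inj₁ []
  unique⊎duplicate (x ∷ xs) u xs⊆ with unique⊎duplicate xs u (λ p → xs⊆ (there p))
  ... | inj₂ (duplicate L y M R) = inj₂ (duplicate (x ∷ L) y M R)
  ... | inj₁ xs-unique with ∈?-within-unique xs u (xs⊆ (here refl)) (λ p → xs⊆ (there p))
  ...   | no x∉xs = inj₁ (¬Any⇒All¬ xs x∉xs ∷ xs-unique)
  ...   | yes x∈xs with ∈-∃++ x∈xs
  ...     | M , R , refl = inj₂ (duplicate [] x M R)

  duplicate⇒¬unique : ∀ {xs} → HasDuplicate xs → ¬ Unique xs
  duplicate⇒¬unique (duplicate []      x M R) (x∉ ∷ _) = All.lookup x∉ (∈-++⁺ʳ M (here refl)) refl
  duplicate⇒¬unique (duplicate (_ ∷ L) x M R) (_ ∷ u)  = duplicate⇒¬unique (duplicate L x M R) u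

  length-++-∷ : ∀ P (y : A) Q → length (P ++ Q) < length (P ++ y ∷ Q)
  length-++-∷ []      y Q = ≤-refl
  length-++-∷ (p ∷ P) y Q = s≤s (length-++-∷ P y Q)

  length-mergeˡ : ∀ L (x : A) M R → length (L ++ x ∷ M ++ R) < length (L ++ x ∷ M ++ x ∷ R)
  length-mergeˡ []      x M R = s≤s (length-++-∷ M x R)
  length-mergeˡ (l ∷ L) x M R = s≤s (length-mergeˡ L x M R)

  ∈-insert⁻ : ∀ P {Q} {x y : A} → y ∈ P ++ x ∷ Q → y ≡ x ⊎ y ∈ P ++ Q
  ∈-insert⁻ []      (here y≡x) = inj₁ y≡x
  ∈-insert⁻ []      (there p)  = inj₂ p
  ∈-insert⁻ (w ∷ P) (here y≡w) = inj₂ (here y≡w)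
  ∈-insert⁻ (w ∷ P) (there p)  = Sum.map₂ there (∈-insert⁻ P p)

  ⊆-insert : ∀ P {Q} {x : A} → P ++ Q ⊆ P ++ x ∷ Q
  ⊆-insert P p = [ ∈-++⁺ˡ , (λ q → ∈-++⁺ʳ P (there q)) ]′ (∈-++⁻ P p)

  insert-⊆ : ∀ P {Q} {x : A} → x ∈ P ++ Q → P ++ x ∷ Q ⊆ P ++ Q
  insert-⊆ P x∈ p = [ (λ { refl → x∈ }) , id ]′ (∈-insert⁻ P p)

  swap-⊆ : ∀ P {Q} {x y : A} → P ++ x ∷ y ∷ Q ⊆ P ++ y ∷ x ∷ Q
  swap-⊆ P = ∈-resp-↭ (++⁺ˡ P (↭-swap _ _ ↭-refl))

  ⊆-mergedˡ : ∀ L {x : A} M R → L ++ x ∷ M ++ x ∷ R ⊆ L ++ x ∷ M ++ R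
  ⊆-mergedˡ L M R p with ∈-++⁻ L p
  ... | inj₁ p∈L          = ∈-++⁺ˡ p∈L
  ... | inj₂ (here y≡x)   = ∈-++⁺ʳ L (here y≡x)
  ... | inj₂ (there p∈MR) = ∈-++⁺ʳ L ([ here , there ]′ (∈-insert⁻ M p∈MR))

  ⊆-mergedʳ : ∀ L {x : A} M R → L ++ x ∷ M ++ x ∷ R ⊆ L ++ M ++ x ∷ R
  ⊆-mergedʳ L M R p = [ (λ { refl → ∈-++⁺ʳ L (∈-++⁺ʳ M (here refl)) }) , id ]′ (∈-insert⁻ L p)

  mergedˡ-⊆ : ∀ L {x : A} M R → L ++ x ∷ M ++ R ⊆ L ++ x ∷ M ++ x ∷ R
  mergedˡ-⊆ L M R p with ∈-++⁻ L p
  ... | inj₁ p∈L         = ∈-++⁺ˡ p∈L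
  ... | inj₂ (here y≡x)  = ∈-++⁺ʳ L (here y≡x)
  ... | inj₂ (there p∈MR) = ∈-++⁺ʳ L (there (⊆-insert M p∈MR))

  mergedʳ-⊆ : ∀ L {x : A} M R → L ++ M ++ x ∷ R ⊆ L ++ x ∷ M ++ x ∷ R
  mergedʳ-⊆ L M R = ⊆-insert L

  ++-assoc₄ : ∀ (P Q R K : List A) → (P ++ Q ++ R) ++ K ≡ P ++ Q ++ R ++ K
  ++-assoc₄ P Q R K = trans (++-assoc P (Q ++ R) K) (cong (P ++_) (++-assoc Q R K))

  ++-regroup : ∀ (P Q R K : List A) → P ++ (Q ++ R) ++ K ≡ (P ++ Q) ++ R ++ K
  ++-regroup P Q R K = trans (cong (P ++_) (++-assoc Q R K)) (sym (++-assoc P Q (R ++ K)))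

  ++-regroup-assoc : ∀ (P L M R Q : List A) → P ++ (L ++ M ++ R) ++ Q ≡ (P ++ L) ++ M ++ R ++ Q
  ++-regroup-assoc P L M R Q =
    trans (++-regroup P L (M ++ R) Q) (cong ((P ++ L) ++_) (++-assoc M R Q))

  data CutPosition₁ (P Q L : List A) (x : A) (K : List A) : Set a where
    before : ∀ L₂ → L ≡ P ++ L₂ → Q ≡ L₂ ++ x ∷ K → CutPosition₁ P Q L x K
    after  : ∀ K₁ → P ≡ L ++ x ∷ K₁ → K ≡ K₁ ++ Q → CutPosition₁ P Q L x K

  cutPosition₁ : ∀ P Q L x K → P ++ Q ≡ L ++ x ∷ K → CutPosition₁ P Q L x K
  cutPosition₁ []      Q L       x K e = before L refl e
  cutPosition₁ (p ∷ P) Q []      x K e with ∷-injective e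
  ... | refl , refl = after P refl refl
  cutPosition₁ (p ∷ P) Q (l ∷ L) x K e with ∷-injective e
  ... | refl , e′ with cutPosition₁ P Q L x K e′
  ...   | before L₂ refl refl = before L₂ refl refl
  ...   | after K₁ refl refl  = after K₁ refl refl

  data CutPosition (P Q L : List A) (x : A) (M R : List A) : Set a where
    in-L : ∀ L₂ → L ≡ P ++ L₂ → Q ≡ L₂ ++ x ∷ M ++ x ∷ R → CutPosition P Q L x M R
    in-M : ∀ M₁ M₂ → P ≡ L ++ x ∷ M₁ → M ≡ M₁ ++ M₂ → Q ≡ M₂ ++ x ∷ R →
           CutPosition P Q L x M R
    in-R : ∀ R₁ → P ≡ L ++ x ∷ M ++ x ∷ R₁ → R ≡ R₁ ++ Q → CutPosition P Q L x M R

  cutPosition : ∀ P Q L x M R → P ++ Q ≡ L ++ x ∷ M ++ x ∷ R → CutPosition P Q L x M R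
  cutPosition P Q L x M R e with cutPosition₁ P Q L x (M ++ x ∷ R) e
  ... | before L₂ e₁ e₂ = in-L L₂ e₁ e₂
  ... | after K₁ refl e₂ with cutPosition₁ K₁ Q M x R (sym e₂)
  ...   | before M₂ e₃ e₄ = in-M K₁ M₂ refl e₃ e₄
  ...   | after R₁ refl e₄ = in-R R₁ refl e₄

  data EntryPosition (P : List A) (y : A) (Q L : List A) (x : A) (M R : List A) : Set a where
    in-L   : ∀ L₂ → L ≡ P ++ y ∷ L₂ → Q ≡ L₂ ++ x ∷ M ++ x ∷ R → EntryPosition P y Q L x M R
    first  : P ≡ L → y ≡ x → Q ≡ M ++ x ∷ R → EntryPosition P y Q L x M R
    in-M   : ∀ M₁ M₂ → P ≡ L ++ x ∷ M₁ → M ≡ M₁ ++ y ∷ M₂ → Q ≡ M₂ ++ x ∷ R →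
             EntryPosition P y Q L x M R
    second : P ≡ L ++ x ∷ M → y ≡ x → Q ≡ R → EntryPosition P y Q L x M R
    in-R   : ∀ R₁ → P ≡ L ++ x ∷ M ++ x ∷ R₁ → R ≡ R₁ ++ y ∷ Q → EntryPosition P y Q L x M R

  entryPosition : ∀ P y Q L x M R → P ++ y ∷ Q ≡ L ++ x ∷ M ++ x ∷ R → EntryPosition P y Q L x M R
  entryPosition P y Q L x M R e with cutPosition P (y ∷ Q) L x M R e
  ... | in-L []       e₁   refl = first (sym (trans e₁ (++-identityʳ P))) refl refl
  ... | in-L (_ ∷ L₂) refl refl = in-L L₂ refl refl
  ... | in-M M₁ []       refl e₃   refl =
    second (cong (λ N → L ++ x ∷ N) (trans (sym (++-identityʳ M₁)) (sym e₃))) refl refl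
  ... | in-M M₁ (_ ∷ M₂) refl refl refl = in-M M₁ M₂ refl refl refl
  ... | in-R R₁ refl refl = in-R R₁ refl refl

module SmallStep (S : ModeSystem) (Γ : List (ModeSystem.Var S)) (r : ModeSystem.Mode S) where

  open Rules S

  Allows : Struct → Var → Set
  Allows s x = σ (modeOf x) s

  Weakenable : Var → Set
  Weakenable y = Allows W y × modeOf y ≥ r × y ∈ Γ

  -- Contraction adds one copy of a variable already present on the given side, and
  -- mobility is split into exchanges of adjacent hypotheses, justified by Mˡ of the one
  -- moving left or Mʳ of the one moving right.
  infix 4 _⇛_
  data _⇛_ : OCtx → OCtx → Set where
    done      : ∀ {Ω} → nf Ω → Ω ⇛ Ω
    weaken    : ∀ {Ω} P Q y → P ++ y ∷ Q ⇛ Ω → Weakenable y → y ∉ P ++ Q → P ++ Q ⇛ Ω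
    contractˡ : ∀ {Ω} P Q y → P ++ Q ⇛ Ω → Allows Cˡ y → y ∈ P → P ++ y ∷ Q ⇛ Ω
    contractʳ : ∀ {Ω} P Q y → P ++ Q ⇛ Ω → Allows Cʳ y → y ∈ Q → P ++ y ∷ Q ⇛ Ω
    exchange  : ∀ {Ω} P Q y z → P ++ z ∷ y ∷ Q ⇛ Ω → Allows Mˡ z ⊎ Allows Mʳ y →
                P ++ y ∷ z ∷ Q ⇛ Ω

  cast : ∀ {Z Z′ Ω} → Z ≡ Z′ → Z ⇛ Ω → Z′ ⇛ Ω
  cast refl D = D

  target-nf : ∀ {Z Ω} → Z ⇛ Ω → nf Ω
  target-nf (done u)                = u
  target-nf (weaken _ _ _ D _ _)    = target-nf D
  target-nf (contractˡ _ _ _ D _ _) = target-nf D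
  target-nf (contractʳ _ _ _ D _ _) = target-nf D
  target-nf (exchange _ _ _ _ D _)  = target-nf D

  ⊆-target : ∀ {Z Ω} → Z ⇛ Ω → Z ⊆ Ω
  ⊆-target (done _)                    p = p
  ⊆-target (weaken P _ _ D _ _)        p = ⊆-target D (⊆-insert P p)
  ⊆-target (contractˡ P _ _ D _ y∈P)   p = ⊆-target D (insert-⊆ P (∈-++⁺ˡ y∈P) p)
  ⊆-target (contractʳ P _ _ D _ y∈Q)   p = ⊆-target D (insert-⊆ P (∈-++⁺ʳ P y∈Q) p)
  ⊆-target (exchange P _ _ _ D _)      p = ⊆-target D (swap-⊆ P p)

  moveˡ : ∀ {Ω} P M Q x → P ++ x ∷ M ++ Q ⇛ Ω → Allows Mˡ x → P ++ M ++ x ∷ Q ⇛ Ω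
  moveˡ P []      Q x D m = D
  moveˡ P (z ∷ M) Q x D m =
    cast (++-assoc P [ z ] (M ++ x ∷ Q))
      (moveˡ (P ++ [ z ]) M Q x
        (cast (sym (++-assoc P [ z ] (x ∷ M ++ Q))) (exchange P (M ++ Q) z x D (inj₁ m))) m)

  moveʳ : ∀ {Ω} P M Q x → P ++ M ++ x ∷ Q ⇛ Ω → Allows Mʳ x → P ++ x ∷ M ++ Q ⇛ Ω
  moveʳ P []      Q x D m = D
  moveʳ P (z ∷ M) Q x D m =
    exchange P (M ++ Q) x z
      (cast (++-assoc P [ z ] (x ∷ M ++ Q))
        (moveʳ (P ++ [ z ]) M Q x (cast (sym (++-assoc P [ z ] (M ++ x ∷ Q))) D) m))
      (inj₂ m)

  ⇝⇒⇛ : ∀ {Z Ω} → Z ⇝[ Γ , r ] Ω → Z ⇛ Ω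
  ⇝⇒⇛ (⇝W Ωₗ Ωᵣ x D w m g x∉) = weaken Ωₗ Ωᵣ x (⇝⇒⇛ D) (w , m , g) x∉
  ⇝⇒⇛ (⇝Cˡ Ωₗ Ωₘ Ωᵣ x D c) =
    cast (++-assoc Ωₗ (x ∷ Ωₘ) (x ∷ Ωᵣ))
      (contractˡ (Ωₗ ++ x ∷ Ωₘ) Ωᵣ x (cast (sym (++-assoc Ωₗ (x ∷ Ωₘ) Ωᵣ)) (⇝⇒⇛ D)) c
        (∈-++⁺ʳ Ωₗ (here refl)))
  ⇝⇒⇛ (⇝Cʳ Ωₗ Ωₘ Ωᵣ x D c) = contractʳ Ωₗ (Ωₘ ++ x ∷ Ωᵣ) x (⇝⇒⇛ D) c (∈-++⁺ʳ Ωₘ (here refl))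
  ⇝⇒⇛ (⇝Mˡ Ωₗ Ωₘ Ωᵣ x D m) = moveˡ Ωₗ Ωₘ Ωᵣ x (⇝⇒⇛ D) m
  ⇝⇒⇛ (⇝Mʳ Ωₗ Ωₘ Ωᵣ x D m) = moveʳ Ωₗ Ωₘ Ωᵣ x (⇝⇒⇛ D) m
  ⇝⇒⇛ (⇝id u) = done u

  ⇛⇒⇝ : ∀ {Z Ω} → Z ⇛ Ω → Z ⇝[ Γ , r ] Ω
  ⇛⇒⇝ (done u) = ⇝id u
  ⇛⇒⇝ (weaken P Q y D (w , m , g) y∉) = ⇝W P Q y (⇛⇒⇝ D) w m g y∉
  ⇛⇒⇝ {Ω = Ω} (contractˡ P Q y D c y∈P) with ∈-∃++ y∈P
  ... | P₁ , P₂ , refl =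
    subst (_⇝[ Γ , r ] Ω) (sym (++-assoc P₁ (y ∷ P₂) (y ∷ Q)))
      (⇝Cˡ P₁ P₂ Q y (subst (_⇝[ Γ , r ] Ω) (++-assoc P₁ (y ∷ P₂) Q) (⇛⇒⇝ D)) c)
  ⇛⇒⇝ (contractʳ P Q y D c y∈Q) with ∈-∃++ y∈Q
  ... | Q₁ , Q₂ , refl = ⇝Cʳ P Q₁ Q₂ y (⇛⇒⇝ D) c
  ⇛⇒⇝ (exchange P Q y z D (inj₁ m)) = ⇝Mˡ P [ y ] Q z (⇛⇒⇝ D) m
  ⇛⇒⇝ (exchange P Q y z D (inj₂ m)) = ⇝Mʳ P [ z ] Q y (⇛⇒⇝ D) m

  weaken≡ : ∀ {Z Z′ Ω} P Q y → Z′ ≡ P ++ y ∷ Q → P ++ Q ≡ Z →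
            Z′ ⇛ Ω → Weakenable y → y ∉ Z → Z ⇛ Ω
  weaken≡ P Q y refl refl D w y∉ = weaken P Q y D w y∉

  contractˡ≡ : ∀ {Z Z′ Ω} P Q y → Z′ ≡ P ++ Q → P ++ y ∷ Q ≡ Z →
               Z′ ⇛ Ω → Allows Cˡ y → y ∈ P → Z ⇛ Ω
  contractˡ≡ P Q y refl refl D c y∈P = contractˡ P Q y D c y∈P

  contractʳ≡ : ∀ {Z Z′ Ω} P Q y → Z′ ≡ P ++ Q → P ++ y ∷ Q ≡ Z →
               Z′ ⇛ Ω → Allows Cʳ y → y ∈ Q → Z ⇛ Ω
  contractʳ≡ P Q y refl refl D c y∈Q = contractʳ P Q y D c y∈Q

  exchange≡ : ∀ {Z Z′ Ω} P Q y z → Z′ ≡ P ++ z ∷ y ∷ Q → P ++ y ∷ z ∷ Q ≡ Z →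
              Z′ ⇛ Ω → Allows Mˡ z ⊎ Allows Mʳ y → Z ⇛ Ω
  exchange≡ P Q y z refl refl D m = exchange P Q y z D m

  Contractible : OCtx → Var → OCtx → OCtx → OCtx → Set
  Contractible L x M R Ω = Allows Cˡ x × L ++ x ∷ M ++ R ⇛ Ω ⊎ Allows Cʳ x × L ++ M ++ x ∷ R ⇛ Ω

  DuplicatesContractible : OCtx → OCtx → Set
  DuplicatesContractible Z Ω = ∀ L x M R → Z ≡ L ++ x ∷ M ++ x ∷ R → Contractible L x M R Ω

  weaken-contractible : ∀ {Ω} P Q y → DuplicatesContractible (P ++ y ∷ Q) Ω → Weakenable y →
    ∀ L x M R → y ∉ L ++ x ∷ M ++ x ∷ R → CutPosition P Q L x M R → Contractible L x M R Ω
  weaken-contractible P Q y ih w _ x M R y∉ (in-L L₂ refl refl) =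
    Sum.map (map₂ λ D → weaken≡ P _ y (++-assoc P (y ∷ L₂) _) (sym (++-assoc P L₂ _)) D w
                          (λ p → y∉ (mergedˡ-⊆ (P ++ L₂) M R p)))
            (map₂ λ D → weaken≡ P _ y (++-assoc P (y ∷ L₂) _) (sym (++-assoc P L₂ _)) D w
                          (λ p → y∉ (mergedʳ-⊆ (P ++ L₂) M R p)))
            (ih (P ++ y ∷ L₂) x M R (sym (++-assoc P (y ∷ L₂) _)))
  weaken-contractible _ _ y ih w L x _ R y∉ (in-M M₁ M₂ refl refl refl) =
    Sum.map (map₂ λ D → weaken≡ (L ++ x ∷ M₁) (M₂ ++ R) y (++-regroup L (x ∷ M₁) (y ∷ M₂) R)
                          (sym (++-regroup L (x ∷ M₁) M₂ R)) D w
                          (λ p → y∉ (mergedˡ-⊆ L (M₁ ++ M₂) R p)))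
            (map₂ λ D → weaken≡ (L ++ M₁) (M₂ ++ x ∷ R) y (++-regroup L M₁ (y ∷ M₂) (x ∷ R))
                          (sym (++-regroup L M₁ M₂ (x ∷ R))) D w
                          (λ p → y∉ (mergedʳ-⊆ L (M₁ ++ M₂) R p)))
            (ih L x (M₁ ++ y ∷ M₂) R (sym (++-regroup L (x ∷ M₁) (y ∷ M₂) (x ∷ R))))
  weaken-contractible _ Q y ih w L x M _ y∉ (in-R R₁ refl refl) =
    Sum.map (map₂ λ D → weaken≡ (L ++ x ∷ M ++ R₁) Q y (sym (++-assoc₄ L (x ∷ M) R₁ (y ∷ Q)))
                          (++-assoc₄ L (x ∷ M) R₁ Q) D w (λ p → y∉ (mergedˡ-⊆ L M (R₁ ++ Q) p)))
            (map₂ λ D → weaken≡ (L ++ M ++ x ∷ R₁) Q y (sym (++-assoc₄ L M (x ∷ R₁) (y ∷ Q)))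
                          (++-assoc₄ L M (x ∷ R₁) Q) D w (λ p → y∉ (mergedʳ-⊆ L M (R₁ ++ Q) p)))
            (ih L x M (R₁ ++ y ∷ Q) (++-assoc₄ L (x ∷ M) (x ∷ R₁) (y ∷ Q)))

  contractˡ-contractible : ∀ {Ω} P Q y → P ++ Q ⇛ Ω → DuplicatesContractible (P ++ Q) Ω →
    Allows Cˡ y → y ∈ P → ∀ L x M R → EntryPosition P y Q L x M R → Contractible L x M R Ω
  contractˡ-contractible {Ω} P Q y D ih c y∈P _ x M R (in-L L₂ refl refl) =
    Sum.map (map₂ (redo _)) (map₂ (redo _)) (ih (P ++ L₂) x M R (sym (++-assoc P L₂ _)))
    where
      redo : ∀ K → (P ++ L₂) ++ K ⇛ Ω → (P ++ y ∷ L₂) ++ K ⇛ Ω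
      redo K D′ = contractˡ≡ P (L₂ ++ K) y (++-assoc P L₂ K) (sym (++-assoc P (y ∷ L₂) K)) D′ c y∈P
  contractˡ-contractible P Q x D ih c x∈L L x M R (first refl refl refl) with ∈-∃++ x∈L
  ... | L₁ , L₂ , refl =
    Sum.map (map₂ λ D′ → contractˡ≡ (L₁ ++ x ∷ L₂) (M ++ R) x (++-regroup L₁ (x ∷ L₂) M R) refl
                           D′ c (∈-++⁺ʳ L₁ (here refl)))
            (λ (c′ , D′) → c′ , contractʳ≡ L₁ (L₂ ++ M ++ x ∷ R) x
                                  (cong (L₁ ++_) (++-assoc L₂ M (x ∷ R)))
                                  (sym (++-assoc L₁ (x ∷ L₂) _))
                                  D′ c′ (∈-++⁺ʳ L₂ (∈-++⁺ʳ M (here refl))))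
            (ih L₁ x (L₂ ++ M) R (sym (++-regroup L₁ (x ∷ L₂) M (x ∷ R))))
  contractˡ-contractible {Ω} _ _ y D ih c y∈P L x _ R (in-M M₁ M₂ refl refl refl) =
    Sum.map (map₂ λ D′ → contractˡ≡ (L ++ x ∷ M₁) (M₂ ++ R) y (++-regroup L (x ∷ M₁) M₂ R)
                           (sym (++-regroup L (x ∷ M₁) (y ∷ M₂) R)) D′ c y∈P)
            (λ (c′ , D′) → c′ , redoʳ c′ D′ (∈-insert⁻ L y∈P))
            (ih L x (M₁ ++ M₂) R (sym (++-regroup L (x ∷ M₁) M₂ (x ∷ R))))
    where
      redoʳ : Allows Cʳ x → L ++ (M₁ ++ M₂) ++ x ∷ R ⇛ Ω → y ≡ x ⊎ y ∈ L ++ M₁ →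
              L ++ (M₁ ++ y ∷ M₂) ++ x ∷ R ⇛ Ω
      redoʳ c′ D′ (inj₁ refl)  = contractʳ≡ (L ++ M₁) (M₂ ++ x ∷ R) x (++-regroup L M₁ M₂ (x ∷ R))
                                   (sym (++-regroup L M₁ (x ∷ M₂) (x ∷ R))) D′ c′
                                   (∈-++⁺ʳ M₂ (here refl))
      redoʳ c′ D′ (inj₂ y∈LM₁) = contractˡ≡ (L ++ M₁) (M₂ ++ x ∷ R) y (++-regroup L M₁ M₂ (x ∷ R))
                                   (sym (++-regroup L M₁ (y ∷ M₂) (x ∷ R))) D′ c y∈LM₁
  contractˡ-contractible _ _ x D ih c _ L x M R (second refl refl refl) =
    inj₁ (c , cast (++-assoc L (x ∷ M) R) D)
  contractˡ-contractible _ Q y D ih c y∈P L x M _ (in-R R₁ refl refl) =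
    Sum.map (map₂ λ D′ → contractˡ≡ (L ++ x ∷ M ++ R₁) Q y (sym (++-assoc₄ L (x ∷ M) R₁ Q))
                           (++-assoc₄ L (x ∷ M) R₁ (y ∷ Q)) D′ c (⊆-mergedˡ L M R₁ y∈P))
            (map₂ λ D′ → contractˡ≡ (L ++ M ++ x ∷ R₁) Q y (sym (++-assoc₄ L M (x ∷ R₁) Q))
                           (++-assoc₄ L M (x ∷ R₁) (y ∷ Q)) D′ c (⊆-mergedʳ L M R₁ y∈P))
            (ih L x M (R₁ ++ Q) (++-assoc₄ L (x ∷ M) (x ∷ R₁) Q))

  contractʳ-contractible : ∀ {Ω} P Q y → P ++ Q ⇛ Ω → DuplicatesContractible (P ++ Q) Ω →
    Allows Cʳ y → y ∈ Q → ∀ L x M R → EntryPosition P y Q L x M R → Contractible L x M R Ω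
  contractʳ-contractible P _ y D ih c y∈Q _ x M R (in-L L₂ refl refl) =
    Sum.map (map₂ λ D′ → contractʳ≡ P (L₂ ++ x ∷ M ++ R) y (++-assoc P L₂ _)
                           (sym (++-assoc P (y ∷ L₂) _)) D′ c (⊆-mergedˡ L₂ M R y∈Q))
            (map₂ λ D′ → contractʳ≡ P (L₂ ++ M ++ x ∷ R) y (++-assoc P L₂ _)
                           (sym (++-assoc P (y ∷ L₂) _)) D′ c (⊆-mergedʳ L₂ M R y∈Q))
            (ih (P ++ L₂) x M R (sym (++-assoc P L₂ _)))
  contractʳ-contractible _ _ x D ih c _ L x M R (first refl refl refl) = inj₂ (c , D)
  contractʳ-contractible {Ω} _ _ y D ih c y∈Q L x _ R (in-M M₁ M₂ refl refl refl) =
    Sum.map (λ (c′ , D′) → c′ , redoˡ c′ D′ (∈-insert⁻ M₂ y∈Q))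
            (map₂ λ D′ → contractʳ≡ (L ++ M₁) (M₂ ++ x ∷ R) y (++-regroup L M₁ M₂ (x ∷ R))
                           (sym (++-regroup L M₁ (y ∷ M₂) (x ∷ R))) D′ c y∈Q)
            (ih L x (M₁ ++ M₂) R (sym (++-regroup L (x ∷ M₁) M₂ (x ∷ R))))
    where
      redoˡ : Allows Cˡ x → L ++ x ∷ (M₁ ++ M₂) ++ R ⇛ Ω → y ≡ x ⊎ y ∈ M₂ ++ R →
              L ++ x ∷ (M₁ ++ y ∷ M₂) ++ R ⇛ Ω
      redoˡ c′ D′ (inj₁ refl)  = contractˡ≡ (L ++ x ∷ M₁) (M₂ ++ R) x (++-regroup L (x ∷ M₁) M₂ R)
                                   (sym (++-regroup L (x ∷ M₁) (x ∷ M₂) R)) D′ c′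
                                   (∈-++⁺ʳ L (here refl))
      redoˡ c′ D′ (inj₂ y∈M₂R) = contractʳ≡ (L ++ x ∷ M₁) (M₂ ++ R) y (++-regroup L (x ∷ M₁) M₂ R)
                                   (sym (++-regroup L (x ∷ M₁) (y ∷ M₂) R)) D′ c y∈M₂R
  contractʳ-contractible _ _ x D ih c x∈R L x M R (second refl refl refl) with ∈-∃++ x∈R
  ... | R₁ , R₂ , refl =
    Sum.map (λ (c′ , D′) → c′ , contractˡ≡ (L ++ x ∷ M ++ R₁) R₂ x
                                  (sym (++-assoc L (x ∷ M ++ R₁) R₂))
                                  (++-assoc₄ L (x ∷ M) R₁ (x ∷ R₂))
                                  D′ c′ (∈-++⁺ʳ L (here refl)))
            (map₂ λ D′ → contractʳ≡ (L ++ M) (R₁ ++ x ∷ R₂) x (++-regroup L M R₁ (x ∷ R₂))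
                           (++-assoc L M _) D′ c (∈-++⁺ʳ R₁ (here refl)))
            (ih L x (M ++ R₁) R₂ (sym (++-regroup L (x ∷ M) R₁ (x ∷ R₂))))
  contractʳ-contractible _ Q y D ih c y∈Q L x M _ (in-R R₁ refl refl) =
    Sum.map (map₂ λ D′ → contractʳ≡ (L ++ x ∷ M ++ R₁) Q y (sym (++-assoc₄ L (x ∷ M) R₁ Q))
                           (++-assoc₄ L (x ∷ M) R₁ (y ∷ Q)) D′ c y∈Q)
            (map₂ λ D′ → contractʳ≡ (L ++ M ++ x ∷ R₁) Q y (sym (++-assoc₄ L M (x ∷ R₁) Q))
                           (++-assoc₄ L M (x ∷ R₁) (y ∷ Q)) D′ c y∈Q)
            (ih L x M (R₁ ++ Q) (++-assoc₄ L (x ∷ M) (x ∷ R₁) Q))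

  exchange-contractible : ∀ {Ω} P Q y z → DuplicatesContractible (P ++ z ∷ y ∷ Q) Ω →
    Allows Mˡ z ⊎ Allows Mʳ y →
    ∀ L x M R → EntryPosition P y (z ∷ Q) L x M R → Contractible L x M R Ω
  exchange-contractible {Ω} P _ y z ih m _ x M R (in-L (_ ∷ L₃) refl refl) =
    Sum.map (map₂ (redo _)) (map₂ (redo _))
            (ih (P ++ z ∷ y ∷ L₃) x M R (sym (++-assoc P (z ∷ y ∷ L₃) _)))
    where
      redo : ∀ K → (P ++ z ∷ y ∷ L₃) ++ K ⇛ Ω → (P ++ y ∷ z ∷ L₃) ++ K ⇛ Ω
      redo K D′ = exchange≡ P (L₃ ++ K) y z (++-assoc P (z ∷ y ∷ L₃) K)
                    (sym (++-assoc P (y ∷ z ∷ L₃) K)) D′ m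
  exchange-contractible P _ y x ih m _ x M R (in-L [] refl refl) =
    Sum.map (map₂ λ D′ → exchange≡ P (M ++ R) y x refl (sym (++-assoc P [ y ] _)) D′ m)
            (map₂ λ D′ → cast (sym (++-assoc P [ y ] _)) D′)
            (ih P x (y ∷ M) R refl)
  exchange-contractible _ _ x x ih m L x [] R (first refl refl refl) = ih L x [] R refl
  exchange-contractible _ _ x z ih m L x (_ ∷ M) R (first refl refl refl) =
    Sum.map (map₂ λ D′ → exchange≡ L (M ++ R) x z (++-assoc L [ z ] _) refl D′ m)
            (map₂ λ D′ → cast (++-assoc L [ z ] _) D′)
            (ih (L ++ [ z ]) x M R (sym (++-assoc L [ z ] _)))
  exchange-contractible _ _ y x ih m L x _ R (in-M M₁ [] refl refl refl) =
    Sum.map (map₂ λ D′ → cast (cong (λ N → L ++ x ∷ N) (sym (++-assoc M₁ [ y ] R))) D′)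
            (map₂ λ D′ → exchange≡ (L ++ M₁) R y x (sym (++-assoc L M₁ _))
                           (sym (++-regroup L M₁ [ y ] (x ∷ R))) D′ m)
            (ih L x M₁ (y ∷ R) (++-assoc L (x ∷ M₁) _))
  exchange-contractible {Ω} _ _ y z ih m L x _ R (in-M M₁ (_ ∷ M₃) refl refl refl) =
    Sum.map (map₂ (redo L (x ∷ M₁) R)) (map₂ (redo L M₁ (x ∷ R)))
            (ih L x (M₁ ++ z ∷ y ∷ M₃) R (sym (++-regroup L (x ∷ M₁) (z ∷ y ∷ M₃) (x ∷ R))))
    where
      redo : ∀ J N K → J ++ (N ++ z ∷ y ∷ M₃) ++ K ⇛ Ω → J ++ (N ++ y ∷ z ∷ M₃) ++ K ⇛ Ω
      redo J N K D′ = exchange≡ (J ++ N) (M₃ ++ K) y z (++-regroup J N (z ∷ y ∷ M₃) K)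
                        (sym (++-regroup J N (y ∷ z ∷ M₃) K)) D′ m
  exchange-contractible _ Q x z ih m L x M _ (second refl refl refl) =
    Sum.map (map₂ λ D′ → cast (cong (λ N → L ++ x ∷ N) (++-assoc M [ z ] Q)) D′)
            (map₂ λ D′ → exchange≡ (L ++ M) Q x z (++-regroup L M [ z ] (x ∷ Q))
                           (++-assoc L M _) D′ m)
            (ih L x (M ++ [ z ]) Q (sym (++-regroup L (x ∷ M) [ z ] (x ∷ Q))))
  exchange-contractible {Ω} _ Q y z ih m L x M _ (in-R R₁ refl refl) =
    Sum.map (map₂ (redo (x ∷ M) R₁)) (map₂ (redo M (x ∷ R₁)))
            (ih L x M (R₁ ++ z ∷ y ∷ Q) (++-assoc₄ L (x ∷ M) (x ∷ R₁) _))
    where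
      redo : ∀ N₁ N₂ → L ++ N₁ ++ N₂ ++ z ∷ y ∷ Q ⇛ Ω → L ++ N₁ ++ N₂ ++ y ∷ z ∷ Q ⇛ Ω
      redo N₁ N₂ D′ = exchange≡ (L ++ N₁ ++ N₂) Q y z (sym (++-assoc₄ L N₁ N₂ _))
                        (++-assoc₄ L N₁ N₂ _) D′ m

  contractible : ∀ {Z Ω} → Z ⇛ Ω → DuplicatesContractible Z Ω
  contractible (done u) L x M R refl = ⊥-elim (duplicate⇒¬unique (duplicate L x M R) u)
  contractible (weaken P Q y D w y∉) L x M R e =
    weaken-contractible P Q y (contractible D) w L x M R (subst (y ∉_) e y∉)
      (cutPosition P Q L x M R e)
  contractible (contractˡ P Q y D c y∈P) L x M R e =
    contractˡ-contractible P Q y D (contractible D) c y∈P L x M R (entryPosition P y Q L x M R e)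
  contractible (contractʳ P Q y D c y∈Q) L x M R e =
    contractʳ-contractible P Q y D (contractible D) c y∈Q L x M R (entryPosition P y Q L x M R e)
  contractible (exchange P Q y z D m) L x M R e =
    exchange-contractible P Q y z (contractible D) m L x M R (entryPosition P y (z ∷ Q) L x M R e)

  normalise : ∀ {Ω} Ωₗ Ωₘ Ωᵣ → Ωₗ ++ Ωₘ ++ Ωᵣ ⇛ Ω → Acc _<_ (length Ωₘ) →
              Σ OCtx λ Ωₘ′ → Ωₘ ⇝[ Γ , r ] Ωₘ′ × Ωₗ ++ Ωₘ′ ++ Ωᵣ ⇛ Ω
  normalise Ωₗ Ωₘ Ωᵣ D (acc smaller)
    with unique⊎duplicate Ωₘ (target-nf D) (λ p → ⊆-target D (∈-++⁺ʳ Ωₗ (∈-++⁺ˡ p)))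
  ... | inj₁ Ωₘ-nf = Ωₘ , ⇝id Ωₘ-nf , D
  ... | inj₂ (duplicate L x M R)
    with contractible D (Ωₗ ++ L) x M (R ++ Ωᵣ) (++-regroup-assoc Ωₗ L (x ∷ M) (x ∷ R) Ωᵣ)
  ...   | inj₁ (c , D′) =
    let Ωₘ′ , Ωₘ⇝ , D″ = normalise Ωₗ (L ++ x ∷ M ++ R) Ωᵣ
                           (cast (sym (++-regroup-assoc Ωₗ L (x ∷ M) R Ωᵣ)) D′)
                           (smaller (length-mergeˡ L x M R))
    in Ωₘ′ , ⇝Cˡ L M R x Ωₘ⇝ c , D″
  ...   | inj₂ (c , D′) =
    let Ωₘ′ , Ωₘ⇝ , D″ = normalise Ωₗ (L ++ M ++ x ∷ R) Ωᵣ
                           (cast (sym (++-regroup-assoc Ωₗ L M (x ∷ R) Ωᵣ)) D′)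
                           (smaller (length-++-∷ L x (M ++ x ∷ R)))
    in Ωₘ′ , ⇝Cʳ L M R x Ωₘ⇝ c , D″

  normalise-++ : ∀ {Ω} Ω₁ Ω₂ → Ω₁ ++ Ω₂ ⇛ Ω →
    Σ OCtx λ Ω₁′ → Σ OCtx λ Ω₂′ → Ω₁ ⇝[ Γ , r ] Ω₁′ × Ω₂ ⇝[ Γ , r ] Ω₂′ × Ω₁′ ++ Ω₂′ ⇛ Ω
  normalise-++ Ω₁ Ω₂ D =
    let Ω₂′ , Ω₂⇝ , D₂ = normalise Ω₁ Ω₂ [] (cast (cong (Ω₁ ++_) (sym (++-identityʳ Ω₂))) D)
                                            (<-wellFounded _)
        Ω₁′ , Ω₁⇝ , D₁ = normalise [] Ω₁ Ω₂′ (cast (cong (Ω₁ ++_) (++-identityʳ Ω₂′)) D₂)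
                                             (<-wellFounded _)
    in Ω₁′ , Ω₂′ , Ω₁⇝ , Ω₂⇝ , D₁

-- Ω₁′ and Ω₂′ are reached by contractions alone.
lemma2 : (S : ModeSystem) → let open Rules S in
    (Γ : UCtx) (r : Mode) (Ω₁ Ω₂ : OCtx) →
    (Ω₁ ++ Ω₂) ≥ᶜ r → All (_∈ Γ) (Ω₁ ++ Ω₂) →
    (Ω : OCtx) → NF Γ r (Ω₁ ++ Ω₂) Ω →
    Σ OCtx (λ Ω₁' → Σ OCtx (λ Ω₂' →
      NF Γ r Ω₁ Ω₁' × NF Γ r Ω₂ Ω₂' × ((Ω₁' ++ Ω₂') ⇝[ Γ , r ] Ω)))
lemma2 S Γ r Ω₁ Ω₂ _ _ Ω D =
  let Ω₁′ , Ω₂′ , Ω₁⇝ , Ω₂⇝ , D′ = normalise-++ Ω₁ Ω₂ (⇝⇒⇛ D)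
  in Ω₁′ , Ω₂′ , Ω₁⇝ , Ω₂⇝ , ⇛⇒⇝ D′
  where open SmallStep S Γ r
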